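{- Under the standing assumptions below, let $A\subseteq V_G$ be strongly compressed and slice-compressed, and let $\mathrm{Slice}_G(p)<\mathrm{Slice}_G(q)$ (i.e. $p<q$) be slices with $\mathrm{Slice}_G(q)\cap A\neq\emptyset$ and $\mathrm{Slice}_G(p)\not\subseteq A$. Let $\mathrm{Stack}_G(\alpha_q)$ be the first stack in direction $d$ of $\mathrm{Slice}_G(q)$ and $\mathrm{Stack}_G(\alpha_p)$ the last stack in direction $d$ of $\mathrm{Slice}_G(p)$. Then: (1) every stack in direction $d$ contained in $\mathrm{Slice}_G(q)$ other than $\mathrm{Stack}_G(\alpha_q)$ is disjoint from $A$; (2) every stack in direction $d$ contained in $\mathrm{Slice}_G(p)$ other than $\mathrm{Stack}_G(\alpha_p)$ is contained in $A$; (3) $q=p+1$.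
   Context: All graphs are finite and simple. For $G=(V,E)$, $I_G(A,B)$ is the set of edges with one end in $A$ and the other in $B$, $I_G(A)=I_G(A,A)$, $I_G(m)=\max_{|S|=m}|I_G(S)|$. A total order is a bijection $\mathcal O:V\to\{1,\dots,|V|\}$, $\mathcal O[k,l]=\mathcal O^{ -1}(\{k,\dots,l\})$; it is optimal if $|I_G(\mathcal O[1,k])|=I_G(k)$ for all $k$; $G$ is isoperimetric if it has one. $\delta_G(1)=0$, $\delta_G(m)=I_G(m)-I_G(m-1)$. Cartesian product $G_1\square\cdots\square G_d$: tuples adjacent iff they differ in exactly one coordinate, where they are adjacent. Lexicographic order on $\mathbb R^k$: $x<y$ iff for some $i$, $x_1=y_1,\dots,x_i=y_i$, $x_{i+1}<y_{i+1}$. For $\pi\in\mathfrak S_k$, $\mathcal D^{\pi,k}$ compares $(x_{\pi(1)},\dots,x_{\pi(k)})$ lexicographically; orders on $\mathbb R^k$ induce orders on products of ordered sets via rank tuples. Isoperimetric partition of isoperimetric $G$ with optimal $\mathcal O_G$: partition into consecutive intervals $\mathcal O_G[a_i,b_i]$ such that each part induces an isoperimetric subgraph with the restricted order optimal, and every $v\in\mathcal O_G[a_i,b_i]$ has exactly $\delta_G(a_i)$ neighbours in $\mathcal O_G[a_1,b_{i-1}]$. Starts of parts are their first vertices; $\mathfrak T_G$ is the set of starts. Non-decreasing: each part's induced subgraph has non-decreasing $\delta$-sequence. Regular: first and last parts' induced subgraphs have equal $\delta$-sequences. Setup: $G_i$ ($1\le i\le d$) isoperimetric with fixed optimal orders $\mathcal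 O_{G_i}$ and isoperimetric partitions $\mathfrak P_{G_i}$; $G=G_1\square\cdots\square G_d$; $G_S=G_{i_1}\square\cdots\square G_{i_k}$ for $S=\{i_1<\dots<i_k\}$. Blocks of $G_S$: $Z_{i_1}\times\cdots\times Z_{i_k}$, $Z_{i_j}\in\mathfrak P_{G_{i_j}}$; start: tuple of starts. An order $\mathcal O$ on a product is consistent with an order $\mathcal O'$ on the subproduct over $S$ if $x<_{\mathcal O}y$ and $x_j=y_j$ for $j\notin S$ imply the same inequality of projections in $\mathcal O'$. Domination collection: each block $B$ of each $G_S$ has $\pi_B\in\mathfrak S_{|S|}$ such that the order $\mathcal D_B$ induced by $\mathcal D^{\pi_B,|S|}$ on $B$ (coordinates ranked by restrictions of $\mathcal O_{G_{i_j}}$) is optimal for the subgraph induced by $B$, and for $S_1\subset S_2$, $\mathcal D_{B_2}$ is consistent with $\mathcal D_{B_1}$ when $B_1$ consists of the factors of $B_2$ indexed by $S_1$. $\mathcal{BL}^k_{G_S}$: same block: compare by $\mathcal D_B$; different blocks: compare starts lexicographically; $\mathcal{BL}^d_G=\mathcal{BL}^d_{G_{\{1,\dots,d\}}}$. Regular domination collection: $\mathfrak P_{G_i}$ regular for $2\le i\le d-1$, and $\pi_{B_1}=\pi_{B_2}$ for $B_1$ (resp. $B_2$) the product of the first (resp. last) parts of $\mathfrak P_{G_2},\dots,\mathfrak P_{G_{d-1}}$. Standing assumptions: $d\ge3$; the $\mathfrak P_{G_i}$ form a regular domination collection; $\mathfrak P_{G_i}$ non-decreasing for $i\le d-1$;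 $\mathcal{BL}^2_{G_i\square G_j}$ optimal for all $i<j$. Compression: for nonempty proper $S$ with an order on $G_S$, and $x\in V_{G_{\overline S}}$, the section $G_S(x)$ is the set of vertices of $G$ with $\overline S$-coordinates equal to $x$, ordered via its isomorphism with $G_S$; compression replaces each $A\cap G_S(x)$ by the initial segment of $G_S(x)$ of the same size. $A$ is strongly compressed if it is unchanged by compression for every nonempty proper $S$ with respect to $\mathcal{BL}^{|S|}_{G_S}$. Geometry: blocks of $G$ are ordered by $\mathcal{BL}^d_G$ of their starts. With $t_1,t_2,\dots$ the starts of the parts of $\mathfrak P_{G_1}$ in increasing $\mathcal O_{G_1}$-order, $\mathrm{Slice}_G(q)$ is the union of all blocks whose start has first coordinate $t_q$; slices are ordered by index. $A$ is slice-compressed if for every slice with blocks $B_1<\dots<B_p$ and $r$ the largest index with $A\cap B_r\ne\emptyset$, $B_i\subseteq A$ for all $i<r$. For $\sigma\in\mathfrak T_{G_1}\times\cdots\times\mathfrak T_{G_{d-1}}$, the stack in direction $d$ at $\sigma$ is the union over $s\in\mathfrak T_{G_d}$ of the blocks with start $(\sigma,s)$; each slice is a disjoint union of such stacks, and stacks are ordered by comparing their first (smallest) blocks. -}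

module Defs where

open import Data.Bool using (Bool; true; false; _∧_; _∨_; not; if_then_else_)
open import Data.Nat using (ℕ; zero; suc; _+_; _∸_; _⊔_; _≤_; _<_; _≡ᵇ_; _<ᵇ_)
import Data.Nat as ℕ
open import Data.Fin using (Fin; toℕ)
open import Data.List using (List; []; _∷_; _++_; map; foldr; length; take; drop; upTo; allFin; concatMap)
open import Data.Nat.ListAction using (sum)
open import Data.List.Membership.Propositional using (_∈_)
open import Data.List.Relation.Binary.Permutation.Propositional using (_↭_)
open import Data.Vec using (Vec; tabulate) renaming (lookup to vlookup; [] to v[]; _∷_ to _v∷_)
open import Data.Vec.Properties using (≡-dec)
import Data.Fin.Subset as Sub
open import Data.Maybe using (Maybe; just; nothing)
open import Data.Product using (Σ; _×_; ∃; ∃₂; _,_)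
open import Relation.Binary.PropositionalEquality using (_≡_; _≢_)
open import Relation.Binary.Definitions using (DecidableEquality)
open import Relation.Nullary using (¬_)
open import Relation.Nullary.Decidable using (⌊_⌋)

filterB : {A : Set} → (A → Bool) → List A → List A
filterB p [] = []
filterB p (x ∷ xs) = if p x then x ∷ filterB p xs else filterB p xs

countB : {A : Set} → (A → Bool) → List A → ℕ
countB p xs = length (filterB p xs)

-- all sub-lists (= all subsets, for a duplicate-free list)
sublists : {A : Set} → List A → List (List A)
sublists [] = [] ∷ []
sublists (x ∷ xs) = map (x ∷_) (sublists xs) ++ sublists xs

-- element at a position (0-based), default 0
nthOr : List ℕ → ℕ → ℕ
nthOr [] _ = 0
nthOr (x ∷ xs) zero = x
nthOr (x ∷ xs) (suc k) = nthOr xs k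

idxOf : ℕ → List ℕ → ℕ
idxOf v [] = 0
idxOf v (x ∷ xs) = if v ≡ᵇ x then 0 else suc (idxOf v xs)

minBy : {A : Set} → (A → A → Bool) → List A → Maybe A
minBy lt [] = nothing
minBy lt (x ∷ xs) = just (go x xs)
  where
  go : _ → List _ → _
  go m [] = m
  go m (y ∷ ys) = go (if lt y m then y else m) ys

record RawGraph : Set₁ where
  field
    V     : Set
    deq   : DecidableEquality V
    verts : List V
    adj   : V → V → Bool
open RawGraph public

induce : (H : RawGraph) → List (V H) → RawGraph
induce H L = record { V = V H ; deq = deq H ; verts = L ; adj = adj H }

-- number of edges with both ends in a (duplicate-free) list: |I_H(S)|
edgesL : {A : Set} → (A → A → Bool) → List A → ℕ
edgesL a [] = 0
edgesL a (x ∷ xs) = countB (a x) xs + edgesL a xs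

IG : RawGraph → ℕ → ℕ
IG H m = foldr _⊔_ 0 (map (edgesL (adj H)) (filterB (λ L → length L ≡ᵇ m) (sublists (verts H))))

δ : RawGraph → ℕ → ℕ
δ H m = IG H m ∸ IG H (m ∸ 1)

-- an order given as a list (first element has position 1) is optimal
OptimalList : (H : RawGraph) → List (V H) → Set
OptimalList H o = ∀ k → k ≤ length (verts H) → edgesL (adj H) (take k o) ≡ IG H k

-- an order given by a strict comparison; O[1,k] = vertices with fewer than k predecessors
initSeg : (H : RawGraph) → (V H → V H → Bool) → ℕ → List (V H)
initSeg H lt k = filterB (λ v → countB (λ u → lt u v) (verts H) <ᵇ k) (verts H)

OptimalCmp : (H : RawGraph) → (V H → V H → Bool) → Set
OptimalCmp H lt = ∀ k → k ≤ length (verts H) → edgesL (adj H) (initSeg H lt k) ≡ IG H k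

NonDecSeq : RawGraph → Set
NonDecSeq H = ∀ m → 1 ≤ m → suc m ≤ length (verts H) → δ H m ≤ δ H (suc m)

record FGraph : Set where
  field
    n    : ℕ
    fadj : ℕ → ℕ → Bool
open FGraph public

raw : FGraph → RawGraph
raw G = record { V = ℕ ; deq = ℕ._≟_ ; verts = upTo (n G) ; adj = fadj G }

Simple : FGraph → Set
Simple G = (∀ u v → u < n G → v < n G → fadj G u v ≡ fadj G v u)
         × (∀ v → v < n G → fadj G v v ≡ false)

-- Partitions into consecutive intervals of an order o, given by the
-- list of lengths of the parts.

offset : (ls : List ℕ) → ℕ → ℕ
offset ls j = sum (take j ls)

partAt : List ℕ → (ls : List ℕ) → ℕ → List ℕ
partAt o ls j = take (nthOr ls j) (drop (offset ls j) o)

IsoPartition : (G : FGraph) → (o : List ℕ) → (ls : List ℕ) → Set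
IsoPartition G o ls =
    (∀ j → j < length ls → 1 ≤ nthOr ls j)
  × (sum ls ≡ n G)
  × (∀ j → j < length ls →
        OptimalList (induce (raw G) (partAt o ls j)) (partAt o ls j)
      × (∀ v → v ∈ partAt o ls j →
           countB (fadj G v) (take (offset ls j) o) ≡ δ (raw G) (suc (offset ls j))))

NonDecreasingP : FGraph → List ℕ → List ℕ → Set
NonDecreasingP G o ls = ∀ j → j < length ls → NonDecSeq (induce (raw G) (partAt o ls j))

RegularP : FGraph → List ℕ → List ℕ → Set
RegularP G o ls =
  let F = induce (raw G) (partAt o ls 0)
      L = induce (raw G) (partAt o ls (length ls ∸ 1))
  in (length (verts F) ≡ length (verts L))
   × (∀ m → 1 ≤ m → m ≤ length (verts F) → δ F m ≡ δ L m)

-- start offset (0-based position) of the part containing position r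
stFrom : ℕ → List ℕ → ℕ → ℕ
stFrom a [] r = a
stFrom a (m ∷ ms) r = if r <ᵇ a + m then a else stFrom (a + m) ms r

-- The data of the setup: d factor graphs, their orders, partitions,
-- and a choice of permutation π_B for every block B of every G_S
-- (π_B is given as the list [i_{π(1)},…,i_{π(k)}] of coordinates).
-- Vertices of G_S are vectors in ℕ^d with coordinate 0 outside S.

record Data (d : ℕ) : Set where
  field
    Gs  : Fin d → FGraph
    os  : Fin d → List ℕ
    lss : Fin d → List ℕ
    pis : Sub.Subset d → Vec ℕ d → List (Fin d)
open Data public

module _ {d : ℕ} (D : Data d) where

  inS : Sub.Subset d → Fin d → Bool
  inS S i = vlookup S i

  elemsS : Sub.Subset d → List (Fin d)
  elemsS S = filterB (inS S) (allFin d)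

  boxes : {k : ℕ} → Vec ℕ k → List (Vec ℕ k)
  boxes v[] = v[] ∷ []
  boxes (b v∷ bs) = concatMap (λ x → map (x v∷_) (boxes bs)) (upTo b)

  eqV : Vec ℕ d → Vec ℕ d → Bool
  eqV x y = ⌊ ≡-dec ℕ._≟_ x y ⌋

  adjP : Vec ℕ d → Vec ℕ d → Bool
  adjP x y =
       (countB (λ i → not (vlookup x i ≡ᵇ vlookup y i)) (allFin d) ≡ᵇ 1)
     ∧ foldr _∧_ true (map (λ i → (vlookup x i ≡ᵇ vlookup y i) ∨ fadj (Gs D i) (vlookup x i) (vlookup y i)) (allFin d))

  GS : Sub.Subset d → RawGraph
  GS S = record
    { V = Vec ℕ d
    ; deq = ≡-dec ℕ._≟_
    ; verts = boxes (tabulate (λ i → if inS S i then n (Gs D i) else 1))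
    ; adj = adjP }

  Gfull : RawGraph
  Gfull = GS Sub.⊤

  restrict : Sub.Subset d → Vec ℕ d → Vec ℕ d
  restrict S x = tabulate (λ i → if inS S i then vlookup x i else 0)

  rank : Fin d → ℕ → ℕ
  rank i v = idxOf v (os D i)

  -- start vertex of the part of P_{G_i} containing v
  startVertex : Fin d → ℕ → ℕ
  startVertex i v = nthOr (os D i) (stFrom 0 (lss D i) (rank i v))

  -- start of the block of G_S containing x
  blockStart : Sub.Subset d → Vec ℕ d → Vec ℕ d
  blockStart S x = tabulate (λ i → if inS S i then startVertex i (vlookup x i) else 0)

  blockVerts : Sub.Subset d → Vec ℕ d → List (Vec ℕ d)
  blockVerts S s = filterB (λ x → eqV (blockStart S x) s) (verts (GS S))

  lexLt : List (Fin d) → Vec ℕ d → Vec ℕ d → Bool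
  lexLt [] x y = false
  lexLt (i ∷ ps) x y =
    (rank i (vlookup x i) <ᵇ rank i (vlookup y i))
    ∨ ((rank i (vlookup x i) ≡ᵇ rank i (vlookup y i)) ∧ lexLt ps x y)

  BL : Sub.Subset d → Vec ℕ d → Vec ℕ d → Bool
  BL S x y =
    if eqV (blockStart S x) (blockStart S y)
    then lexLt (pis D S (blockStart S x)) x y
    else lexLt (elemsS S) (blockStart S x) (blockStart S y)

  DominationCollection : Set
  DominationCollection =
      (∀ S → Sub.Nonempty S → ∀ x → x ∈ verts (GS S) →
          (pis D S (blockStart S x) ↭ elemsS S)
        × OptimalCmp (induce (GS S) (blockVerts S (blockStart S x)))
                     (lexLt (pis D S (blockStart S x))))
    × (∀ S₁ S₂ → Sub.Nonempty S₁ → S₁ Sub.⊂ S₂ → ∀ x → x ∈ verts (GS S₂) →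
          ∀ y z → y ∈ blockVerts S₂ (blockStart S₂ x) → z ∈ blockVerts S₂ (blockStart S₂ x) →
          (∀ j → inS S₁ j ≡ false → vlookup y j ≡ vlookup z j) →
          lexLt (pis D S₂ (blockStart S₂ x)) y z ≡ true →
          lexLt (pis D S₁ (restrict S₁ (blockStart S₂ x))) (restrict S₁ y) (restrict S₁ z) ≡ true)

  -- middle coordinates 2,…,d-1 (1-based)
  Smid : Sub.Subset d
  Smid = tabulate (λ i → (1 ℕ.≤ᵇ toℕ i) ∧ (suc (toℕ i) <ᵇ d))

  firstStarts lastStarts : Vec ℕ d
  firstStarts = tabulate (λ i → if inS Smid i then nthOr (os D i) 0 else 0)
  lastStarts = tabulate (λ i → if inS Smid i
    then nthOr (os D i) (offset (lss D i) (length (lss D i) ∸ 1)) else 0)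

  RegularDominationCollection : Set
  RegularDominationCollection =
      DominationCollection
    × (∀ i → 1 ≤ toℕ i → suc (toℕ i) < d → RegularP (Gs D i) (os D i) (lss D i))
    × (pis D Smid firstStarts ≡ pis D Smid lastStarts)

  pair : Fin d → Fin d → Sub.Subset d
  pair i j = tabulate (λ k → ⌊ k Data.Fin.≟ i ⌋ ∨ ⌊ k Data.Fin.≟ j ⌋)

  record Standing : Set where
    field
      simple    : ∀ i → Simple (Gs D i)
      isOrder   : ∀ i → os D i ↭ upTo (n (Gs D i))
      optimal   : ∀ i → OptimalList (raw (Gs D i)) (os D i)
      partition : ∀ i → IsoPartition (Gs D i) (os D i) (lss D i)
      regDom    : RegularDominationCollection
      nonDecr   : ∀ i → suc (toℕ i) < d → NonDecreasingP (Gs D i) (os D i) (lss D i)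
      bl2       : ∀ i j → i Data.Fin.< j → OptimalCmp (GS (pair i j)) (BL (pair i j))

  VG : List (Vec ℕ d)
  VG = verts Gfull

  section : Sub.Subset d → Vec ℕ d → List (Vec ℕ d)
  section S v = filterB (λ w → eqV (restrict (Sub.∁ S) w) (restrict (Sub.∁ S) v)) VG

  compress : Sub.Subset d → (Vec ℕ d → Bool) → Vec ℕ d → Bool
  compress S A v =
    countB (λ w → BL S (restrict S w) (restrict S v)) (section S v) <ᵇ countB A (section S v)

  StronglyCompressed : (Vec ℕ d → Bool) → Set
  StronglyCompressed A = ∀ S → Sub.Nonempty S → Sub.Nonempty (Sub.∁ S) →
    ∀ v → v ∈ VG → compress S A v ≡ A v

module _ {d₁ : ℕ} (D : Data (suc d₁)) where

  bs : Vec ℕ (suc d₁) → Vec ℕ (suc d₁)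
  bs = blockStart D Sub.⊤

  BLG : Vec ℕ (suc d₁) → Vec ℕ (suc d₁) → Bool
  BLG = BL D Sub.⊤

  -- t_q : start of the q-th part (0-based) of P_{G_1}
  tStart : ℕ → ℕ
  tStart q = nthOr (os D Data.Fin.zero) (offset (lss D Data.Fin.zero) q)

  -- the (0-based) q-th slice
  InSlice : ℕ → Vec ℕ (suc d₁) → Set
  InSlice q w = (q < length (lss D Data.Fin.zero)) × (vlookup (bs w) Data.Fin.zero ≡ tStart q)

  SliceCompressed : (Vec ℕ (suc d₁) → Bool) → Set
  SliceCompressed A = ∀ q x → x ∈ VG D → InSlice q x →
    (∃ λ z → z ∈ VG D × bs z ≡ bs x × A z ≡ true) →
    (∀ y → y ∈ VG D → InSlice q y → BLG (bs x) (bs y) ≡ true →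
       ∀ z → z ∈ VG D → bs z ≡ bs y → A z ≡ false) →
    ∀ y → y ∈ VG D → InSlice q y → BLG (bs y) (bs x) ≡ true →
       ∀ z → z ∈ VG D → bs z ≡ bs y → A z ≡ true

  -- stacks in direction d: identified by the first d-1 coordinates of block starts
  stackKey : Vec ℕ (suc d₁) → Vec ℕ (suc d₁)
  stackKey w = tabulate (λ i → if toℕ i <ᵇ d₁ then vlookup (bs w) i else 0)

  firstBlock : Vec ℕ (suc d₁) → Maybe (Vec ℕ (suc d₁))
  firstBlock σ = minBy BLG (map bs (filterB (λ w → eqV D (stackKey w) σ) (VG D)))

  StackLt : Vec ℕ (suc d₁) → Vec ℕ (suc d₁) → Set
  StackLt σ σ' = ∃₂ λ b b' → firstBlock σ ≡ just b × firstBlock σ' ≡ just b' × BLG b b' ≡ true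

  StackInSlice : ℕ → Vec ℕ (suc d₁) → Set
  StackInSlice q σ = ∃ λ w → w ∈ VG D × InSlice q w × stackKey w ≡ σ

  FirstStack : ℕ → Vec ℕ (suc d₁) → Set
  FirstStack q σ = StackInSlice q σ × (∀ σ' → StackInSlice q σ' → σ' ≢ σ → StackLt σ σ')

  LastStack : ℕ → Vec ℕ (suc d₁) → Set
  LastStack q σ = StackInSlice q σ × (∀ σ' → StackInSlice q σ' → σ' ≢ σ → StackLt σ' σ)

-- Strong compression is used only through one monotonicity principle: if two vertices agree outside a
-- direction S and the first precedes the second in BL_S, then membership of the second in A forces that of
-- the first.  For S containing the first coordinate this moves membership to earlier slices (keeping the
-- last coordinate, or the middle ones); for S = all but the first coordinate it moves membership to lower
-- stacks of the same slice, stacks being compared through the block starts of the middle coordinates.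
-- Let u ∉ A lie in slice p and w ∈ A in slice q.  (1) If w lies outside the first stack of slice q, splice
-- the first coordinate of w, the middle coordinates of a block of the first stack and the last coordinate
-- of u: the result is below w along stacks and above u across slices, so u ∈ A.  (2) is symmetric.
-- (3) If q > p + 1, the vertex with first coordinate t_(p+1), the middle coordinates of u and the last
-- coordinate of w sits between u and w across slices, so again u ∈ A.

module Submission where

open import Defs
open import Data.Bool using (Bool; true; false; not; _∧_; _∨_; if_then_else_)
open import Data.Bool.Properties using (T-≡)
open import Data.Fin using (Fin; toℕ; fromℕ; inject₁) renaming (zero to fz; suc to fs)
import Data.Fin.Properties as Finₚ
import Data.Fin.Subset as Sub
open import Data.List using (List; []; _∷_; _++_; map; length; upTo; allFin)
import Data.List as List
import Data.List.Properties as Listₚ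
open import Data.List.Membership.Propositional using (_∈_; find; lose)
import Data.List.Membership.Propositional.Properties as ∈ₚ
open import Data.List.Relation.Unary.Any using (here; there)
open import Data.List.Relation.Unary.All.Properties using (All¬⇒¬Any)
open import Data.List.Relation.Unary.AllPairs using (_∷_)
open import Data.List.Relation.Unary.Unique.Propositional using (Unique)
import Data.List.Relation.Unary.Unique.Propositional.Properties as Uniqueₚ
open import Data.List.Relation.Binary.Permutation.Propositional using (_↭_; ↭-sym; ↭⇒↭ₛ′)
import Data.List.Relation.Binary.Permutation.Propositional.Properties as ↭ₚ
import Data.List.Relation.Binary.Permutation.Setoid.Properties as ↭ₛₚ
open import Data.Maybe using (just)
open import Data.Nat using (ℕ; zero; suc; _+_; _≤_; _<_; z≤n; s≤s; _<ᵇ_; _≡ᵇ_; _≤ᵇ_)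
import Data.Nat as ℕ
open import Data.Nat.ListAction using (sum)
open import Data.Nat.Properties
  using (<ᵇ⇒<; <⇒<ᵇ; ≡ᵇ⇒≡; ≡⇒≡ᵇ; ≤-refl; ≤-trans; <-trans; ≤-<-trans; <-≤-trans; <-irrefl; <⇒≱; ≮⇒≥;
         m≤m+n; m<m+n; n<1+n; ≤-antisym; m≤n⇒m≤1+n; +-assoc; +-identityʳ; +-monoʳ-<)
open import Data.Product using (_×_; ∃; _,_; proj₁; proj₂)
open import Data.Sum using (_⊎_; inj₁; inj₂)
open import Data.Vec using (Vec; tabulate) renaming (lookup to vlookup; [] to []; _∷_ to _∷ᵥ_)
import Data.Vec.Properties as Vecₚ
open import Data.Vec.Relation.Binary.Pointwise.Extensional using (ext; Pointwise-≡⇒≡)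
open import Function.Bundles using (Equivalence)
open import Relation.Binary.PropositionalEquality
  using (_≡_; _≢_; refl; sym; trans; cong; subst; subst₂; setoid; isEquivalence; module ≡-Reasoning)
open import Relation.Nullary using (yes; no; contradiction)

<⇒<ᵇ≡true : ∀ {m n} → m < n → (m <ᵇ n) ≡ true
<⇒<ᵇ≡true m<n = Equivalence.to T-≡ (<⇒<ᵇ m<n)

<ᵇ≡true⇒< : ∀ {m n} → (m <ᵇ n) ≡ true → m < n
<ᵇ≡true⇒< {m} {n} eq = <ᵇ⇒< m n (Equivalence.from T-≡ eq)

≤⇒<ᵇ≡false : ∀ {m n} → n ≤ m → (m <ᵇ n) ≡ false
≤⇒<ᵇ≡false {m} {n} n≤m with m <ᵇ n in eq
... | false = refl
... | true  = contradiction n≤m (<⇒≱ (<ᵇ≡true⇒< eq))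

<ᵇ≡false⇒≥ : ∀ {m n} → (m <ᵇ n) ≡ false → n ≤ m
<ᵇ≡false⇒≥ eq = ≮⇒≥ (λ m<n → contradiction (trans (sym (<⇒<ᵇ≡true m<n)) eq) λ ())

≡ᵇ-refl : ∀ n → (n ≡ᵇ n) ≡ true
≡ᵇ-refl n = Equivalence.to T-≡ (≡⇒≡ᵇ n n refl)

≡ᵇ≡true⇒≡ : ∀ {m n} → (m ≡ᵇ n) ≡ true → m ≡ n
≡ᵇ≡true⇒≡ {m} {n} eq = ≡ᵇ⇒≡ m n (Equivalence.from T-≡ eq)

if-false : ∀ {A : Set} {b} {x y : A} → b ≡ false → (if b then x else y) ≡ y
if-false refl = refl

if-true : ∀ {A : Set} {b} {x y : A} → b ≡ true → (if b then x else y) ≡ x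
if-true refl = refl

contraposeᵇ : ∀ {a b} → (a ≡ true → b ≡ true) → b ≡ false → a ≡ false
contraposeᵇ {false} _   _  = refl
contraposeᵇ {true}  a⇒b ¬b = contradiction (trans (sym (a⇒b refl)) ¬b) λ ()

vec-ext : ∀ {k} {x y : Vec ℕ k} → (∀ i → vlookup x i ≡ vlookup y i) → x ≡ y
vec-ext h = Pointwise-≡⇒≡ (ext h)

module _ {A : Set} where

  countB-mono : (p q : A → Bool) → (∀ x → p x ≡ true → q x ≡ true) →
    ∀ xs → countB p xs ≤ countB q xs
  countB-mono p q p⇒q [] = z≤n
  countB-mono p q p⇒q (x ∷ xs) with p x in px | q x in qx
  ... | true  | true  = s≤s (countB-mono p q p⇒q xs)
  ... | true  | false = contradiction (trans (sym (p⇒q x px)) qx) λ ()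
  ... | false | true  = m≤n⇒m≤1+n (countB-mono p q p⇒q xs)
  ... | false | false = countB-mono p q p⇒q xs

  countB-mono-< : (p q : A → Bool) → (∀ x → p x ≡ true → q x ≡ true) →
    ∀ xs {y} → y ∈ xs → p y ≡ false → q y ≡ true → countB p xs < countB q xs
  countB-mono-< p q p⇒q (x ∷ xs) (here refl) py qy rewrite py | qy = s≤s (countB-mono p q p⇒q xs)
  countB-mono-< p q p⇒q (x ∷ xs) (there y∈xs) py qy with p x in px | q x in qx
  ... | true  | true  = s≤s (countB-mono-< p q p⇒q xs y∈xs py qy)
  ... | true  | false = contradiction (trans (sym (p⇒q x px)) qx) λ ()
  ... | false | true  = m≤n⇒m≤1+n (countB-mono-< p q p⇒q xs y∈xs py qy)
  ... | false | false = countB-mono-< p q p⇒q xs y∈xs py qy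

  ∈-filterB⁺ : (p : A → Bool) → ∀ xs {y} → y ∈ xs → p y ≡ true → y ∈ filterB p xs
  ∈-filterB⁺ p (x ∷ xs) (here refl) py rewrite py = here refl
  ∈-filterB⁺ p (x ∷ xs) (there y∈xs) py with p x
  ... | true  = there (∈-filterB⁺ p xs y∈xs py)
  ... | false = ∈-filterB⁺ p xs y∈xs py

  ∈-filterB⁻ : (p : A → Bool) → ∀ xs {y} → y ∈ filterB p xs → y ∈ xs × p y ≡ true
  ∈-filterB⁻ p (x ∷ xs) y∈ with p x in px
  ∈-filterB⁻ p (x ∷ xs) (here refl)  | true = here refl , px
  ∈-filterB⁻ p (x ∷ xs) (there y∈)   | true = let y∈xs , py = ∈-filterB⁻ p xs y∈ in there y∈xs , py
  ∈-filterB⁻ p (x ∷ xs) y∈           | false = let y∈xs , py = ∈-filterB⁻ p xs y∈ in there y∈xs , py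

  minBy-∈ : (lt : A → A → Bool) → ∀ xs {m} → minBy lt xs ≡ just m → m ∈ xs
  minBy-∈ lt (x ∷ xs) = go x xs
    where
    go : ∀ c ys {m} → minBy lt (c ∷ ys) ≡ just m → m ∈ c ∷ ys
    go c []       refl = here refl
    go c (y ∷ ys) eq with lt y c
    ... | true  = there (go y ys eq)
    ... | false with go c ys eq
    ...   | here m≡c = here m≡c
    ...   | there m∈ys = there (there m∈ys)

filterB-all : ∀ {A : Set} (p : A → Bool) xs → (∀ x → x ∈ xs → p x ≡ true) → filterB p xs ≡ xs
filterB-all p []       _   = refl
filterB-all p (x ∷ xs) all rewrite all x (here refl) = cong (x ∷_) (filterB-all p xs (λ y y∈ → all y (there y∈)))

tabulate-snoc : ∀ {A : Set} {m} (f : Fin (suc m) → A) →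
  List.tabulate f ≡ List.tabulate (λ k → f (inject₁ k)) ++ f (fromℕ m) ∷ []
tabulate-snoc {m = zero}  f = refl
tabulate-snoc {m = suc m} f = cong (f fz ∷_) (tabulate-snoc (λ k → f (fs k)))

nthOr-idxOf : ∀ xs {v} → v ∈ xs → nthOr xs (idxOf v xs) ≡ v
nthOr-idxOf (x ∷ xs) {v} v∈ with v ≡ᵇ x in eq
... | true = sym (≡ᵇ≡true⇒≡ eq)
nthOr-idxOf (x ∷ xs) {v} (here refl)  | false = contradiction (trans (sym (≡ᵇ-refl v)) eq) λ ()
nthOr-idxOf (x ∷ xs) {v} (there v∈xs) | false = nthOr-idxOf xs v∈xs

idxOf<length : ∀ xs {v} → v ∈ xs → idxOf v xs < length xs
idxOf<length (x ∷ xs) {v} v∈ with v ≡ᵇ x in eq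
... | true = s≤s z≤n
idxOf<length (x ∷ xs) {v} (here refl)  | false = contradiction (trans (sym (≡ᵇ-refl v)) eq) λ ()
idxOf<length (x ∷ xs) {v} (there v∈xs) | false = s≤s (idxOf<length xs v∈xs)

nthOr-∈ : ∀ xs {k} → k < length xs → nthOr xs k ∈ xs
nthOr-∈ (x ∷ xs) {zero}  _         = here refl
nthOr-∈ (x ∷ xs) {suc k} (s≤s k<n) = there (nthOr-∈ xs k<n)

idxOf-nthOr : ∀ xs → Unique xs → ∀ {k} → k < length xs → idxOf (nthOr xs k) xs ≡ k
idxOf-nthOr (x ∷ xs) _ {zero} _ rewrite ≡ᵇ-refl x = refl
idxOf-nthOr (x ∷ xs) (x∉xs ∷ u) {suc k} (s≤s k<n) with nthOr xs k ≡ᵇ x in eq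
... | true  = contradiction (subst (_∈ xs) (≡ᵇ≡true⇒≡ eq) (nthOr-∈ xs k<n)) (All¬⇒¬Any x∉xs)
... | false = cong suc (idxOf-nthOr xs u k<n)

PositiveParts : List ℕ → Set
PositiveParts ls = ∀ j → j < length ls → 1 ≤ nthOr ls j

module _ {m ms} (pos : PositiveParts (m ∷ ms)) where

  head-positive : 1 ≤ m
  head-positive = pos 0 (s≤s z≤n)

  tail-positive : PositiveParts ms
  tail-positive j j<n = pos (suc j) (s≤s j<n)

stFrom-≥ : ∀ a ls r → a ≤ stFrom a ls r
stFrom-≥ a []       r = ≤-refl
stFrom-≥ a (m ∷ ms) r with r <ᵇ a + m
... | true  = ≤-refl
... | false = ≤-trans (m≤m+n a m) (stFrom-≥ (a + m) ms r)

stFrom-≤ : ∀ a ls r → a ≤ r → stFrom a ls r ≤ r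
stFrom-≤ a []       r a≤r = a≤r
stFrom-≤ a (m ∷ ms) r a≤r with r <ᵇ a + m in eq
... | true  = a≤r
... | false = stFrom-≤ (a + m) ms r (<ᵇ≡false⇒≥ eq)

stFrom-idem : ∀ a ls → PositiveParts ls → ∀ r → stFrom a ls (stFrom a ls r) ≡ stFrom a ls r
stFrom-idem a []       pos r = refl
stFrom-idem a (m ∷ ms) pos r with r <ᵇ a + m
... | true  rewrite <⇒<ᵇ≡true (m<m+n a (head-positive pos)) = refl
... | false rewrite ≤⇒<ᵇ≡false (stFrom-≥ (a + m) ms r) = stFrom-idem (a + m) ms (tail-positive pos) r

stFrom-offset : ∀ a ls → PositiveParts ls → ∀ {j} → j < length ls →
  stFrom a ls (a + offset ls j) ≡ a + offset ls j
stFrom-offset a (m ∷ ms) pos {zero} _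
  rewrite +-identityʳ a | <⇒<ᵇ≡true (m<m+n a (head-positive pos)) = refl
stFrom-offset a (m ∷ ms) pos {suc j} (s≤s j<n)
  rewrite sym (+-assoc a m (offset ms j)) | ≤⇒<ᵇ≡false (m≤m+n (a + m) (offset ms j))
  = stFrom-offset (a + m) ms (tail-positive pos) j<n

offset<sum : ∀ ls → PositiveParts ls → ∀ {j} → j < length ls → offset ls j < sum ls
offset<sum (m ∷ ms) pos {zero}  _         = ≤-trans (head-positive pos) (m≤m+n m (sum ms))
offset<sum (m ∷ ms) pos {suc j} (s≤s j<n) = +-monoʳ-< m (offset<sum ms (tail-positive pos) j<n)

offset-mono-< : ∀ ls → PositiveParts ls → ∀ {j j′} → j < j′ → j′ < length ls → offset ls j < offset ls j′
offset-mono-< (m ∷ ms) pos {zero}  {suc j′} _         _ = ≤-trans (head-positive pos) (m≤m+n m (offset ms j′))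
offset-mono-< (m ∷ ms) pos {suc j} {suc j′} (s≤s j<j′) (s≤s j′<n) =
  +-monoʳ-< m (offset-mono-< ms (tail-positive pos) j<j′ j′<n)

module _ {d} (D : Data d) where

  eqV≡true⇒≡ : ∀ {x y} → eqV D x y ≡ true → x ≡ y
  eqV≡true⇒≡ {x} {y} eq with Vecₚ.≡-dec ℕ._≟_ x y
  ... | yes x≡y = x≡y

  ≡⇒eqV≡true : ∀ {x y} → x ≡ y → eqV D x y ≡ true
  ≡⇒eqV≡true {x} {y} x≡y with Vecₚ.≡-dec ℕ._≟_ x y
  ... | yes _   = refl
  ... | no  x≢y = contradiction x≡y x≢y

  ≢⇒eqV≡false : ∀ {x y} → x ≢ y → eqV D x y ≡ false
  ≢⇒eqV≡false {x} {y} x≢y with Vecₚ.≡-dec ℕ._≟_ x y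
  ... | yes x≡y = contradiction x≡y x≢y
  ... | no  _   = refl

  ∈-boxes⁺ : ∀ {k} (bnd x : Vec ℕ k) → (∀ i → vlookup x i < vlookup bnd i) → x ∈ boxes D bnd
  ∈-boxes⁺ []        []       _ = here refl
  ∈-boxes⁺ (b ∷ᵥ bnd) (x ∷ᵥ xs) x<bnd =
    ∈ₚ.∈-concatMap⁺ (λ y → map (y ∷ᵥ_) (boxes D bnd))
      (lose (∈ₚ.∈-upTo⁺ (x<bnd fz)) (∈ₚ.∈-map⁺ (x ∷ᵥ_) (∈-boxes⁺ bnd xs (λ i → x<bnd (fs i)))))

  ∈-boxes-∷⁻ : ∀ {k} {b x} (bnd xs : Vec ℕ k) → (x ∷ᵥ xs) ∈ boxes D (b ∷ᵥ bnd) → x < b × xs ∈ boxes D bnd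
  ∈-boxes-∷⁻ {b = b} bnd xs x∈
    with y , y<b , x∈′ ← find (∈ₚ.∈-concatMap⁻ (λ y → map (y ∷ᵥ_) (boxes D bnd)) {xs = upTo b} x∈)
    with _ , xs∈ , refl ← ∈ₚ.∈-map⁻ (y ∷ᵥ_) x∈′
    = ∈ₚ.∈-upTo⁻ y<b , xs∈

  ∈-boxes⁻ : ∀ {k} (bnd x : Vec ℕ k) → x ∈ boxes D bnd → ∀ i → vlookup x i < vlookup bnd i
  ∈-boxes⁻ (b ∷ᵥ bnd) (x ∷ᵥ xs) x∈ fz     = proj₁ (∈-boxes-∷⁻ {b = b} bnd xs x∈)
  ∈-boxes⁻ (b ∷ᵥ bnd) (x ∷ᵥ xs) x∈ (fs i) = ∈-boxes⁻ bnd xs (proj₂ (∈-boxes-∷⁻ {b = b} bnd xs x∈)) i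

private
  lexStep : ℕ → ℕ → Bool → Bool
  lexStep a b l = (a <ᵇ b) ∨ ((a ≡ᵇ b) ∧ l)

  lexStep⁻ : ∀ a b l → lexStep a b l ≡ true → a < b ⊎ (a ≡ b × l ≡ true)
  lexStep⁻ a b l eq with a <ᵇ b in lt | a ≡ᵇ b in ab
  ... | true  | _    = inj₁ (<ᵇ≡true⇒< lt)
  ... | false | true = inj₂ (≡ᵇ≡true⇒≡ ab , eq)

  lexStep-< : ∀ {a b} l → a < b → lexStep a b l ≡ true
  lexStep-< l a<b rewrite <⇒<ᵇ≡true a<b = refl

  lexStep-≡ : ∀ a {l} → l ≡ true → lexStep a a l ≡ true
  lexStep-≡ a l rewrite ≤⇒<ᵇ≡false (≤-refl {a}) | ≡ᵇ-refl a = l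

  lexStep-cong : ∀ {a a′ b b′ l l′} → a ≡ a′ → b ≡ b′ → l ≡ l′ → lexStep a b l ≡ lexStep a′ b′ l′
  lexStep-cong refl refl refl = refl

  lexStep-refl : ∀ a l → lexStep a a l ≡ l
  lexStep-refl a l rewrite ≤⇒<ᵇ≡false (≤-refl {a}) | ≡ᵇ-refl a = refl

module Orders {d} (D : Data d) where

  rankAt : Fin d → Vec ℕ d → ℕ
  rankAt i x = rank D i (vlookup x i)

  SameRanks : List (Fin d) → Vec ℕ d → Vec ℕ d → Set
  SameRanks ps x y = ∀ j → j ∈ ps → rankAt j x ≡ rankAt j y

  lexLt-∷⁻ : ∀ {i} ps {x y} → lexLt D (i ∷ ps) x y ≡ true →
    rankAt i x < rankAt i y ⊎ (rankAt i x ≡ rankAt i y × lexLt D ps x y ≡ true)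
  lexLt-∷⁻ {i} ps {x} {y} = lexStep⁻ (rankAt i x) (rankAt i y) (lexLt D ps x y)

  lexLt-∷-< : ∀ {i} ps {x y} → rankAt i x < rankAt i y → lexLt D (i ∷ ps) x y ≡ true
  lexLt-∷-< ps = lexStep-< _

  lexLt-∷-≡ : ∀ {i} ps {x y} → rankAt i x ≡ rankAt i y → lexLt D ps x y ≡ true → lexLt D (i ∷ ps) x y ≡ true
  lexLt-∷-≡ {i} ps {x} {y} eq lt =
    subst (λ b → lexStep (rankAt i x) b (lexLt D ps x y) ≡ true) eq (lexStep-≡ (rankAt i x) lt)

  lexLt-irrefl : ∀ ps x → lexLt D ps x x ≡ false
  lexLt-irrefl []       x = refl
  lexLt-irrefl (i ∷ ps) x = trans (lexStep-refl (rankAt i x) _) (lexLt-irrefl ps x)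

  lexLt-trans : ∀ ps {x y z} → lexLt D ps x y ≡ true → lexLt D ps y z ≡ true → lexLt D ps x z ≡ true
  lexLt-trans (i ∷ ps) {x} {y} {z} x<y y<z
    with lexLt-∷⁻ ps x<y | lexLt-∷⁻ ps y<z
  ... | inj₁ a       | inj₁ b       = lexLt-∷-< ps (<-trans a b)
  ... | inj₁ a       | inj₂ (b , _) = lexLt-∷-< ps (subst (rankAt i x <_) b a)
  ... | inj₂ (a , _) | inj₁ b       = lexLt-∷-< ps (subst (_< rankAt i z) (sym a) b)
  ... | inj₂ (a , l) | inj₂ (b , m) = lexLt-∷-≡ ps (trans a b) (lexLt-trans ps l m)

  lexLt-cong : ∀ ps {x y x′ y′} → SameRanks ps x′ x → SameRanks ps y′ y → lexLt D ps x′ y′ ≡ lexLt D ps x y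
  lexLt-cong []       _  _  = refl
  lexLt-cong (i ∷ ps) hx hy =
    lexStep-cong (hx i (here refl)) (hy i (here refl))
      (lexLt-cong ps (λ j j∈ → hx j (there j∈)) (λ j j∈ → hy j (there j∈)))

  lexLt-++⁻ : ∀ ps qs {x y} → lexLt D (ps ++ qs) x y ≡ true →
    lexLt D ps x y ≡ true ⊎ (SameRanks ps x y × lexLt D qs x y ≡ true)
  lexLt-++⁻ []       qs lt = inj₂ ((λ _ ()) , lt)
  lexLt-++⁻ (i ∷ ps) qs lt with lexLt-∷⁻ (ps ++ qs) lt
  ... | inj₁ a = inj₁ (lexLt-∷-< ps a)
  ... | inj₂ (a , l) with lexLt-++⁻ ps qs l
  ...   | inj₁ b       = inj₁ (lexLt-∷-≡ ps a b)
  ...   | inj₂ (b , c) = inj₂ ((λ { j (here refl) → a ; j (there j∈) → b j j∈ }) , c)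

  lexLt-++⁺ˡ : ∀ ps qs {x y} → lexLt D ps x y ≡ true → lexLt D (ps ++ qs) x y ≡ true
  lexLt-++⁺ˡ (i ∷ ps) qs lt with lexLt-∷⁻ ps lt
  ... | inj₁ a       = lexLt-∷-< (ps ++ qs) a
  ... | inj₂ (a , l) = lexLt-∷-≡ (ps ++ qs) a (lexLt-++⁺ˡ ps qs l)

  module _ (S : Sub.Subset d) where

    private
      start : Vec ℕ d → Vec ℕ d
      start = blockStart D S

    BL-sameBlock : ∀ {x y} → start x ≡ start y → lexLt D (pis D S (start x)) x y ≡ true → BL D S x y ≡ true
    BL-sameBlock eq lt rewrite ≡⇒eqV≡true D eq = lt

    BL-otherBlock : ∀ {x y} → start x ≢ start y → lexLt D (elemsS D S) (start x) (start y) ≡ true → BL D S x y ≡ true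
    BL-otherBlock ne lt rewrite ≢⇒eqV≡false D ne = lt

    BL⁻ : ∀ {x y} → BL D S x y ≡ true →
        (start x ≡ start y × lexLt D (pis D S (start x)) x y ≡ true)
      ⊎ (start x ≢ start y × lexLt D (elemsS D S) (start x) (start y) ≡ true)
    BL⁻ {x} {y} lt with eqV D (start x) (start y) in eq
    ... | true  = inj₁ (eqV≡true⇒≡ D eq , lt)
    ... | false = inj₂ ((λ e → contradiction (trans (sym (≡⇒eqV≡true D e)) eq) λ ()) , lt)

    BL-irrefl : ∀ x → BL D S x x ≡ false
    BL-irrefl x rewrite ≡⇒eqV≡true D {start x} refl = lexLt-irrefl (pis D S (start x)) x

    BL-trans : ∀ {x y z} → BL D S x y ≡ true → BL D S y z ≡ true → BL D S x z ≡ true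
    BL-trans {x} {y} {z} x<y y<z with BL⁻ x<y | BL⁻ y<z
    ... | inj₁ (xy , a) | inj₁ (yz , b) =
      BL-sameBlock (trans xy yz)
        (lexLt-trans (pis D S (start x)) a (subst (λ s → lexLt D (pis D S s) y z ≡ true) (sym xy) b))
    ... | inj₁ (xy , _) | inj₂ (yz , b) =
      BL-otherBlock (λ xz → yz (trans (sym xy) xz)) (subst (λ s → lexLt D (elemsS D S) s (start z) ≡ true) (sym xy) b)
    ... | inj₂ (xy , a) | inj₁ (yz , _) =
      BL-otherBlock (λ xz → xy (trans xz (sym yz))) (subst (λ s → lexLt D (elemsS D S) (start x) s ≡ true) yz a)
    ... | inj₂ (_ , a)  | inj₂ (_ , b) = BL-otherBlock xz-differ x<z
      where
      x<z : lexLt D (elemsS D S) (start x) (start z) ≡ true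
      x<z = lexLt-trans (elemsS D S) a b

      xz-differ : start x ≢ start z
      xz-differ xz = contradiction (trans (sym (subst (λ s → lexLt D (elemsS D S) s (start z) ≡ true) xz x<z))
                                          (lexLt-irrefl (elemsS D S) (start z))) λ ()

  -- Compression makes A ∩ (section through w) an initial segment for BL_S: a vertex lies in A iff
  -- it has fewer than |A ∩ section| predecessors in the section.
  compressed-downward : (A : Vec ℕ d → Bool) → StronglyCompressed D A →
    ∀ S → Sub.Nonempty S → Sub.Nonempty (Sub.∁ S) →
    ∀ {v w} → v ∈ VG D → w ∈ VG D → restrict D (Sub.∁ S) v ≡ restrict D (Sub.∁ S) w →
    BL D S (restrict D S v) (restrict D S w) ≡ true → A w ≡ true → A v ≡ true
  compressed-downward A sc S ne ne∁ {v} {w} v∈ w∈ same v<w Aw with A v in Av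
  ... | true  = refl
  ... | false = contradiction (<-≤-trans (<-trans before-v<before-w before-w<inA) inA≤before-v) (<-irrefl refl)
    where
    sec : List (Vec ℕ d)
    sec = section D S w

    before : Vec ℕ d → Vec ℕ d → Bool
    before y x = BL D S (restrict D S x) (restrict D S y)

    same-section : section D S v ≡ sec
    same-section = cong (λ r → filterB (λ x → eqV D (restrict D (Sub.∁ S) x) r) (VG D)) same

    before-v<before-w : countB (before v) sec < countB (before w) sec
    before-v<before-w =
      countB-mono-< (before v) (before w) (λ x x<v → BL-trans S x<v v<w) sec
        (∈-filterB⁺ _ (VG D) v∈ (≡⇒eqV≡true D same)) (BL-irrefl S (restrict D S v)) v<w

    before-w<inA : countB (before w) sec < countB A sec
    before-w<inA = <ᵇ≡true⇒< (trans (sc S ne ne∁ w w∈) Aw)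

    inA≤before-v : countB A sec ≤ countB (before v) sec
    inA≤before-v = <ᵇ≡false⇒≥ (subst (λ L → (countB (before v) L <ᵇ countB A L) ≡ false) same-section
                                     (trans (sc S ne ne∁ v v∈) Av))

module Factors {d} (D : Data d)
  (isOrder  : ∀ i → os D i ↭ upTo (n (Gs D i)))
  (positive : ∀ i → PositiveParts (lss D i))
  (sizes    : ∀ i → sum (lss D i) ≡ n (Gs D i)) where

  open Orders D

  order-∈⁺ : ∀ i {v} → v < n (Gs D i) → v ∈ os D i
  order-∈⁺ i v<n = ↭ₚ.∈-resp-↭ (↭-sym (isOrder i)) (∈ₚ.∈-upTo⁺ v<n)

  order-∈⁻ : ∀ i {v} → v ∈ os D i → v < n (Gs D i)
  order-∈⁻ i v∈ = ∈ₚ.∈-upTo⁻ (↭ₚ.∈-resp-↭ (isOrder i) v∈)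

  order-unique : ∀ i → Unique (os D i)
  order-unique i =
    ↭ₛₚ.Unique-resp-↭ (setoid ℕ) (↭⇒↭ₛ′ isEquivalence (↭-sym (isOrder i))) (Uniqueₚ.upTo⁺ (n (Gs D i)))

  length-order : ∀ i → length (os D i) ≡ n (Gs D i)
  length-order i = trans (↭ₚ.↭-length (isOrder i)) (Listₚ.length-upTo (n (Gs D i)))

  rank-injective : ∀ i {u v} → u ∈ os D i → v ∈ os D i → rank D i u ≡ rank D i v → u ≡ v
  rank-injective i u∈ v∈ eq = trans (sym (nthOr-idxOf _ u∈)) (trans (cong (nthOr (os D i)) eq) (nthOr-idxOf _ v∈))

  private
    partIndex<length : ∀ i {v} → v < n (Gs D i) → stFrom 0 (lss D i) (rank D i v) < length (os D i)
    partIndex<length i v<n = ≤-<-trans (stFrom-≤ 0 (lss D i) _ z≤n) (idxOf<length (os D i) (order-∈⁺ i v<n))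

  startVertex-∈ : ∀ i {v} → v < n (Gs D i) → startVertex D i v ∈ os D i
  startVertex-∈ i v<n = nthOr-∈ (os D i) (partIndex<length i v<n)

  startVertex-idem : ∀ i {v} → v < n (Gs D i) → startVertex D i (startVertex D i v) ≡ startVertex D i v
  startVertex-idem i {v} v<n
    rewrite idxOf-nthOr (os D i) (order-unique i) (partIndex<length i v<n)
          | stFrom-idem 0 (lss D i) (positive i) (rank D i v) = refl

  partStart : Fin d → ℕ → ℕ
  partStart i j = nthOr (os D i) (offset (lss D i) j)

  module _ (i : Fin d) {j} (j<len : j < length (lss D i)) where

    private
      offset<length-order : offset (lss D i) j < length (os D i)
      offset<length-order =
        subst (offset (lss D i) j <_) (trans (sizes i) (sym (length-order i))) (offset<sum _ (positive i) j<len)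

    rank-partStart : rank D i (partStart i j) ≡ offset (lss D i) j
    rank-partStart = idxOf-nthOr (os D i) (order-unique i) offset<length-order

    startVertex-partStart : startVertex D i (partStart i j) ≡ partStart i j
    startVertex-partStart
      rewrite rank-partStart | stFrom-offset 0 (lss D i) (positive i) j<len = refl

    partStart<n : partStart i j < n (Gs D i)
    partStart<n = order-∈⁻ i (nthOr-∈ (os D i) offset<length-order)

  lookup-restrict : ∀ S x i → vlookup (restrict D S x) i ≡ (if inS D S i then vlookup x i else 0)
  lookup-restrict S x = Vecₚ.lookup∘tabulate (λ i → if inS D S i then vlookup x i else 0)

  lookup-blockStart : ∀ S x i →
    vlookup (blockStart D S x) i ≡ (if inS D S i then startVertex D i (vlookup x i) else 0)
  lookup-blockStart S x = Vecₚ.lookup∘tabulate (λ i → if inS D S i then startVertex D i (vlookup x i) else 0)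

  lookup-blockStart-⊤ : ∀ x i → vlookup (blockStart D Sub.⊤ x) i ≡ startVertex D i (vlookup x i)
  lookup-blockStart-⊤ x i = trans (lookup-blockStart Sub.⊤ x i) (if-true (Vecₚ.lookup-replicate i true))

  lookup-blockStart-restrict : ∀ S x {j} → inS D S j ≡ true →
    vlookup (blockStart D S (restrict D S x)) j ≡ startVertex D j (vlookup x j)
  lookup-blockStart-restrict S x {j} j∈S
    rewrite lookup-blockStart S (restrict D S x) j | j∈S | lookup-restrict S x j | j∈S = refl

  restrict-cong : ∀ S {x y} → (∀ i → inS D S i ≡ true → vlookup x i ≡ vlookup y i) → restrict D S x ≡ restrict D S y
  restrict-cong S {x} {y} agree =
    vec-ext λ i → trans (lookup-restrict S x i) (trans (pointwise i) (sym (lookup-restrict S y i)))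
    where
    pointwise : ∀ i → (if inS D S i then vlookup x i else 0) ≡ (if inS D S i then vlookup y i else 0)
    pointwise i with inS D S i in i∈S
    ... | true  = agree i i∈S
    ... | false = refl

  private
    bounds : Vec ℕ d
    bounds = tabulate (λ i → if inS D Sub.⊤ i then n (Gs D i) else 1)

    lookup-bounds : ∀ i → vlookup bounds i ≡ n (Gs D i)
    lookup-bounds i = trans (Vecₚ.lookup∘tabulate _ i) (if-true (Vecₚ.lookup-replicate i true))

  ∈VG⁺ : ∀ {x} → (∀ i → vlookup x i < n (Gs D i)) → x ∈ VG D
  ∈VG⁺ {x} x<n = ∈-boxes⁺ D bounds x (λ i → subst (vlookup x i <_) (sym (lookup-bounds i)) (x<n i))

  ∈VG⁻ : ∀ {x} → x ∈ VG D → ∀ i → vlookup x i < n (Gs D i)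
  ∈VG⁻ {x} x∈ i = subst (vlookup x i <_) (lookup-bounds i) (∈-boxes⁻ D bounds x x∈ i)

  blockStart-⊤-idem : ∀ {x} → x ∈ VG D → blockStart D Sub.⊤ (blockStart D Sub.⊤ x) ≡ blockStart D Sub.⊤ x
  blockStart-⊤-idem {x} x∈ = vec-ext λ i → begin
    vlookup (blockStart D Sub.⊤ (blockStart D Sub.⊤ x)) i ≡⟨ lookup-blockStart-⊤ (blockStart D Sub.⊤ x) i ⟩
    startVertex D i (vlookup (blockStart D Sub.⊤ x) i)    ≡⟨ cong (startVertex D i) (lookup-blockStart-⊤ x i) ⟩
    startVertex D i (startVertex D i (vlookup x i))       ≡⟨ startVertex-idem i (∈VG⁻ x∈ i) ⟩
    startVertex D i (vlookup x i)                         ≡⟨ sym (lookup-blockStart-⊤ x i) ⟩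
    vlookup (blockStart D Sub.⊤ x) i                      ∎
    where open ≡-Reasoning

  elems-⊤ : elemsS D Sub.⊤ ≡ allFin d
  elems-⊤ = filterB-all (inS D Sub.⊤) (allFin d) (λ i _ → Vecₚ.lookup-replicate i true)

  BL-⊤-blockStarts⁻ : ∀ {x y} → x ∈ VG D → y ∈ VG D →
    BL D Sub.⊤ (blockStart D Sub.⊤ x) (blockStart D Sub.⊤ y) ≡ true →
    lexLt D (allFin d) (blockStart D Sub.⊤ x) (blockStart D Sub.⊤ y) ≡ true
  BL-⊤-blockStarts⁻ {x} {y} x∈ y∈ lt with BL⁻ Sub.⊤ lt
  ... | inj₁ (same , lt′) =
    contradiction (trans (sym lt′) (subst (λ s → lexLt D ps (start x) s ≡ false) starts≡ (lexLt-irrefl ps (start x))))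
                  λ ()
    where
    start : Vec ℕ d → Vec ℕ d
    start = blockStart D Sub.⊤

    ps : List (Fin d)
    ps = pis D Sub.⊤ (start (start x))

    starts≡ : start x ≡ start y
    starts≡ = trans (sym (blockStart-⊤-idem x∈)) (trans same (blockStart-⊤-idem y∈))
  ... | inj₂ (_ , lt′) =
    subst₂ (λ s s′ → lexLt D (allFin d) s s′ ≡ true) (blockStart-⊤-idem x∈) (blockStart-⊤-idem y∈)
      (subst (λ ps → lexLt D ps (bs² x) (bs² y) ≡ true) elems-⊤ lt′)
    where
    bs² : Vec ℕ d → Vec ℕ d
    bs² z = blockStart D Sub.⊤ (blockStart D Sub.⊤ z)

module Slices {d₁} (D : Data (suc d₁))
  (isOrder  : ∀ i → os D i ↭ upTo (n (Gs D i)))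
  (positive : ∀ i → PositiveParts (lss D i))
  (sizes    : ∀ i → sum (lss D i) ≡ n (Gs D i))
  (A : Vec ℕ (suc d₁) → Bool) (compressed : StronglyCompressed D A) where

  open Orders D
  open Factors D isOrder positive sizes

  firstRank : Vec ℕ (suc d₁) → ℕ
  firstRank x = rank D fz (startVertex D fz (vlookup x fz))

  InSlice-cong : ∀ {q x y} → vlookup x fz ≡ vlookup y fz → InSlice D q y → InSlice D q x
  InSlice-cong x≡y (q<len , y∈q) = q<len , trans (cong (startVertex D fz) x≡y) y∈q

  InSlice-partStart : ∀ {q x} → q < length (lss D fz) → vlookup x fz ≡ partStart fz q → InSlice D q x
  InSlice-partStart q<len x≡t = q<len , trans (cong (startVertex D fz) x≡t) (startVertex-partStart fz q<len)

  firstRank-slice : ∀ {q x} → InSlice D q x → firstRank x ≡ offset (lss D fz) q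
  firstRank-slice (q<len , x∈q) = trans (cong (rank D fz) x∈q) (rank-partStart fz q<len)

  firstRank-mono : ∀ {p q x y} → InSlice D p x → InSlice D q y → p < q → firstRank x < firstRank y
  firstRank-mono {x = x} {y} x∈p y∈q p<q =
    subst₂ _<_ (sym (firstRank-slice {x = x} x∈p)) (sym (firstRank-slice {x = y} y∈q))
      (offset-mono-< (lss D fz) (positive fz) p<q (proj₁ y∈q))

  BL-by-firstRank : ∀ S → inS D S fz ≡ true → ∀ {x y} → firstRank x < firstRank y →
    BL D S (restrict D S x) (restrict D S y) ≡ true
  BL-by-firstRank S fz∈S {x} {y} x<y =
    BL-otherBlock S starts-differ
      (subst (λ ps → lexLt D ps (start x) (start y) ≡ true) (sym elems) (lexLt-∷-< rest ranks<))
    where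
    start : Vec ℕ (suc d₁) → Vec ℕ (suc d₁)
    start z = blockStart D S (restrict D S z)

    ranks< : rankAt fz (start x) < rankAt fz (start y)
    ranks< = subst₂ _<_ (cong (rank D fz) (sym (lookup-blockStart-restrict S x fz∈S)))
                        (cong (rank D fz) (sym (lookup-blockStart-restrict S y fz∈S))) x<y

    starts-differ : start x ≢ start y
    starts-differ eq = <-irrefl (cong (rankAt fz) eq) ranks<

    rest : List (Fin (suc d₁))
    rest = filterB (inS D S) (List.tabulate fs)

    elems : elemsS D S ≡ fz ∷ rest
    elems rewrite fz∈S = refl

  downward-across-slices : ∀ S → inS D S fz ≡ true → Sub.Nonempty (Sub.∁ S) →
    ∀ {p q x y} → x ∈ VG D → y ∈ VG D → (∀ i → inS D (Sub.∁ S) i ≡ true → vlookup x i ≡ vlookup y i) →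
    InSlice D p x → InSlice D q y → p < q → A y ≡ true → A x ≡ true
  downward-across-slices S fz∈S ne∁ {x = x} {y} x∈ y∈ agree x∈p y∈q p<q =
    compressed-downward A compressed S (fz , Vecₚ.lookup⇒[]= fz S fz∈S) ne∁ x∈ y∈
      (restrict-cong (Sub.∁ S) {x} {y} agree) (BL-by-firstRank S fz∈S {x} {y} (firstRank-mono {x = x} {y} x∈p y∈q p<q))

data Coordinate {m} : Fin (suc (suc m)) → Set where
  first  : Coordinate fz
  middle : (k : Fin m) → Coordinate (fs (inject₁ k))
  last   : Coordinate (fs (fromℕ m))

coordinate : ∀ {m} (i : Fin (suc (suc m))) → Coordinate i
coordinate fz     = first
coordinate (fs j) = below j
  where
  below : ∀ {m} (j : Fin (suc m)) → Coordinate (fs j)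
  below {zero}  fz     = last
  below {suc m} fz     = middle fz
  below {suc m} (fs j) with below j
  ... | middle k = middle (fs k)
  ... | last     = last

module Stacks (e : ℕ) (D : Data (suc (suc (suc e))))
  (isOrder  : ∀ i → os D i ↭ upTo (n (Gs D i)))
  (positive : ∀ i → PositiveParts (lss D i))
  (sizes    : ∀ i → sum (lss D i) ≡ n (Gs D i))
  (A : Vec ℕ (suc (suc (suc e))) → Bool) (compressed : StronglyCompressed D A) where

  open Orders D
  open Factors D isOrder positive sizes
  open Slices D isOrder positive sizes A compressed

  N d₁ : ℕ
  N  = suc (suc (suc e))
  d₁ = suc (suc e)

  middleCoord : Fin (suc e) → Fin N
  middleCoord k = fs (inject₁ k)

  lastCoord : Fin N
  lastCoord = fs (fromℕ (suc e))

  middles : List (Fin N)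
  middles = List.tabulate middleCoord

  record SameMiddles (x y : Vec ℕ N) : Set where
    constructor sameMiddles
    field at : ∀ k → vlookup x (middleCoord k) ≡ vlookup y (middleCoord k)
  open SameMiddles

  middle<ᵇ : ∀ k → (toℕ (middleCoord k) <ᵇ d₁) ≡ true
  middle<ᵇ k rewrite Finₚ.toℕ-inject₁ k = <⇒<ᵇ≡true (s≤s (Finₚ.toℕ<n k))

  last<ᵇ : (toℕ lastCoord <ᵇ d₁) ≡ false
  last<ᵇ rewrite Finₚ.toℕ-fromℕ e = ≤⇒<ᵇ≡false (≤-refl {e})

  ∉-tabulate : ∀ f i → inS D (Sub.∁ (tabulate f)) i ≡ true → f i ≡ false
  ∉-tabulate f i i∉ = not≡true⇒≡false (begin
    not (f i)                          ≡⟨ cong not (sym (Vecₚ.lookup∘tabulate f i)) ⟩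
    not (vlookup (tabulate f) i)       ≡⟨ sym (Vecₚ.lookup-map i not (tabulate f)) ⟩
    inS D (Sub.∁ (tabulate f)) i       ≡⟨ i∉ ⟩
    true                               ∎)
    where
    open ≡-Reasoning

    not≡true⇒≡false : ∀ {b} → not b ≡ true → b ≡ false
    not≡true⇒≡false {false} _ = refl

  allButLast allButFirst firstAndLast : Sub.Subset N
  allButLast   = tabulate (λ i → toℕ i <ᵇ d₁)
  allButFirst  = tabulate (λ i → 1 ≤ᵇ toℕ i)
  firstAndLast = tabulate (λ i → (toℕ i ≡ᵇ 0) ∨ (toℕ i ≡ᵇ d₁))

  agree-outside-allButLast : ∀ {x y : Vec ℕ N} → vlookup x lastCoord ≡ vlookup y lastCoord →
    ∀ i → inS D (Sub.∁ allButLast) i ≡ true → vlookup x i ≡ vlookup y i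
  agree-outside-allButLast x≡y i i∉ with coordinate i
  ... | first    = contradiction i∉ λ ()
  ... | middle k = contradiction (trans (sym (middle<ᵇ k)) (∉-tabulate (λ i → toℕ i <ᵇ d₁) (middleCoord k) i∉)) λ ()
  ... | last     = x≡y

  agree-outside-allButFirst : ∀ {x y : Vec ℕ N} → vlookup x fz ≡ vlookup y fz →
    ∀ i → inS D (Sub.∁ allButFirst) i ≡ true → vlookup x i ≡ vlookup y i
  agree-outside-allButFirst x≡y fz     _  = x≡y
  agree-outside-allButFirst x≡y (fs j) i∉ = contradiction (∉-tabulate (λ i → 1 ≤ᵇ toℕ i) (fs j) i∉) λ ()

  agree-outside-firstAndLast : ∀ {x y} → SameMiddles x y →
    ∀ i → inS D (Sub.∁ firstAndLast) i ≡ true → vlookup x i ≡ vlookup y i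
  agree-outside-firstAndLast x≡y i i∉ with coordinate i
  ... | first    = contradiction i∉ λ ()
  ... | middle k = at x≡y k
  ... | last     = contradiction (∉-tabulate (λ i → (toℕ i ≡ᵇ 0) ∨ (toℕ i ≡ᵇ d₁)) lastCoord i∉) lastIn
    where
    lastIn : ((toℕ lastCoord ≡ᵇ 0) ∨ (toℕ lastCoord ≡ᵇ d₁)) ≢ false
    lastIn rewrite Finₚ.toℕ-fromℕ e | ≡ᵇ-refl e = λ ()

  spliceAt : ℕ → Vec ℕ N → Vec ℕ N → Fin N → ℕ
  spliceAt a m l i = if toℕ i ≡ᵇ 0 then a else if toℕ i <ᵇ d₁ then vlookup m i else vlookup l i

  splice : ℕ → Vec ℕ N → Vec ℕ N → Vec ℕ N
  splice a m l = tabulate (spliceAt a m l)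

  module _ (a : ℕ) (m l : Vec ℕ N) where

    splice-middle : ∀ k → vlookup (splice a m l) (middleCoord k) ≡ vlookup m (middleCoord k)
    splice-middle k = trans (Vecₚ.lookup∘tabulate (spliceAt a m l) (middleCoord k)) (if-true (middle<ᵇ k))

    splice-last : vlookup (splice a m l) lastCoord ≡ vlookup l lastCoord
    splice-last = trans (Vecₚ.lookup∘tabulate (spliceAt a m l) lastCoord) (if-false last<ᵇ)

    splice-∈VG : a < n (Gs D fz) → m ∈ VG D → l ∈ VG D → splice a m l ∈ VG D
    splice-∈VG a<n m∈ l∈ = ∈VG⁺ bounded
      where
      bounded : ∀ i → vlookup (splice a m l) i < n (Gs D i)
      bounded i with coordinate i
      ... | first    = a<n
      ... | middle k = subst (_< n (Gs D (middleCoord k))) (sym (splice-middle k)) (∈VG⁻ m∈ (middleCoord k))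
      ... | last     = subst (_< n (Gs D lastCoord)) (sym splice-last) (∈VG⁻ l∈ lastCoord)

  SameMiddles⇒SameRanks : ∀ {x y} → SameMiddles x y → SameRanks middles x y
  SameMiddles⇒SameRanks same j j∈ with k , refl ← ∈ₚ.∈-tabulate⁻ {f = middleCoord} j∈ =
    cong (rank D (middleCoord k)) (at same k)

  lexLt-middles-cong : ∀ {x y x′ y′} → SameMiddles x′ x → SameMiddles y′ y → lexLt D middles x′ y′ ≡ lexLt D middles x y
  lexLt-middles-cong x′~x y′~y = lexLt-cong middles (SameMiddles⇒SameRanks x′~x) (SameMiddles⇒SameRanks y′~y)

  private
    keyAt : Vec ℕ N → Fin N → ℕ
    keyAt w i = if toℕ i <ᵇ d₁ then vlookup (bs D w) i else 0

  stackKey-middle : ∀ w k → vlookup (stackKey D w) (middleCoord k) ≡ vlookup (bs D w) (middleCoord k)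
  stackKey-middle w k = trans (Vecₚ.lookup∘tabulate (keyAt w) (middleCoord k)) (if-true (middle<ᵇ k))

  stackKey-last : ∀ w → vlookup (stackKey D w) lastCoord ≡ 0
  stackKey-last w = trans (Vecₚ.lookup∘tabulate (keyAt w) lastCoord) (if-false last<ᵇ)

  stackKey≡⇒SameMiddles : ∀ {x y} → stackKey D x ≡ stackKey D y → SameMiddles (bs D x) (bs D y)
  stackKey≡⇒SameMiddles {x} {y} eq = sameMiddles λ k →
    trans (sym (stackKey-middle x k)) (trans (cong (λ σ → vlookup σ (middleCoord k)) eq) (stackKey-middle y k))

  SameRanks⇒stackKey≡ : ∀ {x y} → x ∈ VG D → y ∈ VG D → vlookup (bs D x) fz ≡ vlookup (bs D y) fz →
    SameRanks middles (bs D x) (bs D y) → stackKey D x ≡ stackKey D y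
  SameRanks⇒stackKey≡ {x} {y} x∈ y∈ first≡ ranks≡ = vec-ext pointwise
    where
    start∈ : ∀ {z} → z ∈ VG D → ∀ i → vlookup (bs D z) i ∈ os D i
    start∈ {z} z∈ i = subst (_∈ os D i) (sym (lookup-blockStart-⊤ z i)) (startVertex-∈ i (∈VG⁻ z∈ i))

    pointwise : ∀ i → vlookup (stackKey D x) i ≡ vlookup (stackKey D y) i
    pointwise i with coordinate i
    ... | first    = first≡
    ... | middle k = begin
      vlookup (stackKey D x) (middleCoord k) ≡⟨ stackKey-middle x k ⟩
      vlookup (bs D x) (middleCoord k)       ≡⟨ rank-injective (middleCoord k) (start∈ x∈ _) (start∈ y∈ _)
                                                   (ranks≡ (middleCoord k) (∈ₚ.∈-tabulate⁺ {f = middleCoord} k)) ⟩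
      vlookup (bs D y) (middleCoord k)       ≡⟨ sym (stackKey-middle y k) ⟩
      vlookup (stackKey D y) (middleCoord k) ∎
      where open ≡-Reasoning
    ... | last     = trans (stackKey-last x) (sym (stackKey-last y))

  elems-allButFirst : elemsS D allButFirst ≡ middles ++ lastCoord ∷ []
  elems-allButFirst =
    trans (filterB-all (inS D allButFirst) (List.tabulate fs) fs∈)
          (tabulate-snoc {m = suc e} fs)
    where
    fs∈ : ∀ i → i ∈ List.tabulate fs → inS D allButFirst i ≡ true
    fs∈ i i∈ with j , refl ← ∈ₚ.∈-tabulate⁻ {f = fs} i∈ = Vecₚ.lookup∘tabulate (λ i → 1 ≤ᵇ toℕ i) (fs j)

  BL-allButFirst : ∀ {x y} → lexLt D middles (bs D x) (bs D y) ≡ true →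
    BL D allButFirst (restrict D allButFirst x) (restrict D allButFirst y) ≡ true
  BL-allButFirst {x} {y} lt =
    BL-otherBlock allButFirst starts-differ
      (subst (λ ps → lexLt D ps (start x) (start y) ≡ true) (sym elems-allButFirst)
             (lexLt-++⁺ˡ middles (lastCoord ∷ []) starts<))
    where
    start : Vec ℕ N → Vec ℕ N
    start z = blockStart D allButFirst (restrict D allButFirst z)

    start-middles : ∀ z → SameMiddles (start z) (bs D z)
    start-middles z = sameMiddles λ k →
      trans (lookup-blockStart-restrict allButFirst z (Vecₚ.lookup∘tabulate (λ i → 1 ≤ᵇ toℕ i) (middleCoord k)))
            (sym (lookup-blockStart-⊤ z (middleCoord k)))

    starts< : lexLt D middles (start x) (start y) ≡ true
    starts< = trans (lexLt-middles-cong (start-middles x) (start-middles y)) lt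

    starts-differ : start x ≢ start y
    starts-differ eq =
      contradiction (trans (sym (subst (λ s → lexLt D middles (start x) s ≡ true) (sym eq) starts<))
                           (lexLt-irrefl middles (start x))) λ ()

  downward-along-stacks : ∀ x y → x ∈ VG D → y ∈ VG D → vlookup x fz ≡ vlookup y fz →
    lexLt D middles (bs D x) (bs D y) ≡ true → A y ≡ true → A x ≡ true
  downward-along-stacks x y x∈ y∈ x≡y lt =
    compressed-downward A compressed allButFirst
      (middleCoord fz , Vecₚ.lookup⇒[]= (middleCoord fz) allButFirst refl)
      (fz , Vecₚ.lookup⇒[]= fz (Sub.∁ allButFirst) refl)
      x∈ y∈ (restrict-cong (Sub.∁ allButFirst) {x} {y} (agree-outside-allButFirst {x} {y} x≡y))
      (BL-allButFirst {x} {y} lt)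

  record BlockOf (σ b : Vec ℕ N) : Set where
    field
      vertex  : Vec ℕ N
      vertex∈ : vertex ∈ VG D
      key     : stackKey D vertex ≡ σ
      start   : bs D vertex ≡ b

  firstBlock⇒BlockOf : ∀ {σ b} → firstBlock D σ ≡ just b → BlockOf σ b
  firstBlock⇒BlockOf fb with y , y∈ , b≡ ← ∈ₚ.∈-map⁻ (bs D) (minBy-∈ (BLG D) _ fb) = record
    { vertex  = y
    ; vertex∈ = proj₁ (∈-filterB⁻ _ (VG D) y∈)
    ; key     = eqV≡true⇒≡ D (proj₂ (∈-filterB⁻ _ (VG D) y∈))
    ; start   = sym b≡
    }

  BL-blockStarts⇒middles< : ∀ {y y′} → y ∈ VG D → y′ ∈ VG D → stackKey D y ≢ stackKey D y′ →
    vlookup (bs D y) fz ≡ vlookup (bs D y′) fz → BLG D (bs D y) (bs D y′) ≡ true →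
    lexLt D middles (bs D y) (bs D y′) ≡ true
  BL-blockStarts⇒middles< {y} {y′} y∈ y′∈ keys≢ first≡ y<y′
    with lexLt-∷⁻ (List.tabulate fs) (BL-⊤-blockStarts⁻ y∈ y′∈ y<y′)
  ... | inj₁ first< = contradiction (cong (rank D fz) first≡) (λ eq → <-irrefl eq first<)
  ... | inj₂ (_ , rest<)
    with lexLt-++⁻ middles (lastCoord ∷ [])
           (subst (λ ps → lexLt D ps (bs D y) (bs D y′) ≡ true) (tabulate-snoc {m = suc e} fs) rest<)
  ...   | inj₁ lt           = lt
  ...   | inj₂ (ranks≡ , _) = contradiction (SameRanks⇒stackKey≡ y∈ y′∈ first≡ ranks≡) keys≢

  record StackBelow (σ σ′ : Vec ℕ N) : Set where
    field
      lower upper : Vec ℕ N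
      lower∈      : lower ∈ VG D
      upper∈      : upper ∈ VG D
      lower-key   : stackKey D lower ≡ σ
      upper-key   : stackKey D upper ≡ σ′
      middles<    : lexLt D middles (bs D lower) (bs D upper) ≡ true

  StackLt⇒StackBelow : ∀ {q σ σ′} → StackInSlice D q σ → StackInSlice D q σ′ → σ ≢ σ′ → StackLt D σ σ′ →
    StackBelow σ σ′
  StackLt⇒StackBelow {σ = σ} {σ′} (w , _ , w∈q , wσ) (w′ , _ , w′∈q , w′σ′) σ≢σ′ (b , b′ , fb , fb′ , b<b′) = record
    { lower     = L.vertex
    ; upper     = U.vertex
    ; lower∈    = L.vertex∈
    ; upper∈    = U.vertex∈
    ; lower-key = L.key
    ; upper-key = U.key
    ; middles<  = BL-blockStarts⇒middles< L.vertex∈ U.vertex∈ (λ eq → σ≢σ′ (trans (sym L.key) (trans eq U.key))) first≡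
                    (subst₂ (λ s s′ → BLG D s s′ ≡ true) (sym L.start) (sym U.start) b<b′)
    }
    where
    module L = BlockOf (firstBlock⇒BlockOf fb)
    module U = BlockOf (firstBlock⇒BlockOf fb′)

    first≡ : vlookup (bs D L.vertex) fz ≡ vlookup (bs D U.vertex) fz
    first≡ = begin
      vlookup (stackKey D L.vertex) fz ≡⟨ cong (λ τ → vlookup τ fz) (trans L.key (sym wσ)) ⟩
      vlookup (stackKey D w) fz        ≡⟨ trans (proj₂ w∈q) (sym (proj₂ w′∈q)) ⟩
      vlookup (stackKey D w′) fz       ≡⟨ cong (λ τ → vlookup τ fz) (trans w′σ′ (sym U.key)) ⟩
      vlookup (stackKey D U.vertex) fz ∎
      where open ≡-Reasoning

  splice-blockStart-middles : ∀ a m l → SameMiddles (bs D (splice a m l)) (bs D m)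
  splice-blockStart-middles a m l = sameMiddles λ k → begin
    vlookup (bs D (splice a m l)) (middleCoord k)         ≡⟨ lookup-blockStart-⊤ (splice a m l) (middleCoord k) ⟩
    startVertex D _ (vlookup (splice a m l) (middleCoord k)) ≡⟨ cong (startVertex D _) (splice-middle a m l k) ⟩
    startVertex D _ (vlookup m (middleCoord k))           ≡⟨ sym (lookup-blockStart-⊤ m (middleCoord k)) ⟩
    vlookup (bs D m) (middleCoord k)                      ∎
    where open ≡-Reasoning

  downward-across-slices-fixing-last : ∀ {p q} x y → x ∈ VG D → y ∈ VG D → vlookup x lastCoord ≡ vlookup y lastCoord →
    InSlice D p x → InSlice D q y → p < q → A y ≡ true → A x ≡ true
  downward-across-slices-fixing-last x y x∈ y∈ last≡ =
    downward-across-slices allButLast refl (lastCoord , Vecₚ.lookup⇒[]= lastCoord (Sub.∁ allButLast) lastOutside)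
      x∈ y∈ (agree-outside-allButLast {x} {y} last≡)
    where
    lastOutside : inS D (Sub.∁ allButLast) lastCoord ≡ true
    lastOutside = trans (Vecₚ.lookup-map lastCoord not allButLast)
                        (cong not (trans (Vecₚ.lookup∘tabulate (λ i → toℕ i <ᵇ d₁) lastCoord) last<ᵇ))

  downward-across-slices-fixing-middles : ∀ {p q} x y → x ∈ VG D → y ∈ VG D → SameMiddles x y →
    InSlice D p x → InSlice D q y → p < q → A y ≡ true → A x ≡ true
  downward-across-slices-fixing-middles x y x∈ y∈ same =
    downward-across-slices firstAndLast refl
      (middleCoord fz , Vecₚ.lookup⇒[]= (middleCoord fz) (Sub.∁ firstAndLast) refl)
      x∈ y∈ (agree-outside-firstAndLast same)

  module _ {p q} (p<q : p < q) where

    earlierSlice-below-upperStack : ∀ {u w σ} → u ∈ VG D → InSlice D p u → w ∈ VG D → InSlice D q w →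
      StackBelow σ (stackKey D w) → A w ≡ true → A u ≡ true
    earlierSlice-below-upperStack {u} {w} u∈ u∈p w∈ w∈q below Aw =
      downward-across-slices-fixing-last u z u∈ z∈ (sym (splice-last (vlookup w fz) lower u)) u∈p
        (InSlice-cong {x = z} {w} refl w∈q) p<q (downward-along-stacks z w z∈ w∈ refl z<w Aw)
      where
      open StackBelow below

      z : Vec ℕ N
      z = splice (vlookup w fz) lower u

      z∈ : z ∈ VG D
      z∈ = splice-∈VG (vlookup w fz) lower u (∈VG⁻ w∈ fz) lower∈ u∈

      z<w : lexLt D middles (bs D z) (bs D w) ≡ true
      z<w = trans (lexLt-middles-cong (splice-blockStart-middles (vlookup w fz) lower u)
                                      (stackKey≡⇒SameMiddles {w} {upper} (sym upper-key))) middles<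

    lowerStack-below-laterSlice : ∀ {y w σ} → y ∈ VG D → InSlice D p y → w ∈ VG D → InSlice D q w →
      StackBelow (stackKey D y) σ → A w ≡ true → A y ≡ true
    lowerStack-below-laterSlice {y} {w} y∈ y∈p w∈ w∈q below Aw =
      downward-along-stacks y z y∈ z∈ refl y<z
        (downward-across-slices-fixing-last z w z∈ w∈ (splice-last (vlookup y fz) upper w)
           (InSlice-cong {x = z} {y} refl y∈p) w∈q p<q Aw)
      where
      open StackBelow below

      z : Vec ℕ N
      z = splice (vlookup y fz) upper w

      z∈ : z ∈ VG D
      z∈ = splice-∈VG (vlookup y fz) upper w (∈VG⁻ y∈ fz) upper∈ w∈

      y<z : lexLt D middles (bs D y) (bs D z) ≡ true
      y<z = trans (lexLt-middles-cong (stackKey≡⇒SameMiddles {y} {lower} (sym lower-key))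
                                      (splice-blockStart-middles (vlookup y fz) upper w)) middles<

    outside-firstStack-disjoint : ∀ {u} → u ∈ VG D → InSlice D p u → A u ≡ false →
      ∀ {α} → FirstStack D q α → ∀ w → w ∈ VG D → InSlice D q w → stackKey D w ≢ α → A w ≡ false
    outside-firstStack-disjoint u∈ u∈p ¬Au (α∈q , α-first) w w∈ w∈q w∉α =
      contraposeᵇ (earlierSlice-below-upperStack u∈ u∈p w∈ w∈q
                     (StackLt⇒StackBelow α∈q w∈q′ (λ eq → w∉α (sym eq)) (α-first _ w∈q′ w∉α))) ¬Au
      where
      w∈q′ : StackInSlice D q (stackKey D w)
      w∈q′ = w , w∈ , w∈q , refl

    outside-lastStack-contained : ∀ {w} → w ∈ VG D → InSlice D q w → A w ≡ true →
      ∀ {α} → LastStack D p α → ∀ y → y ∈ VG D → InSlice D p y → stackKey D y ≢ α → A y ≡ true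
    outside-lastStack-contained w∈ w∈q Aw (α∈p , α-last) y y∈ y∈p y∉α =
      lowerStack-below-laterSlice y∈ y∈p w∈ w∈q (StackLt⇒StackBelow y∈p′ α∈p y∉α (α-last _ y∈p′ y∉α)) Aw
      where
      y∈p′ : StackInSlice D p (stackKey D y)
      y∈p′ = y , y∈ , y∈p , refl

    nonadjacent-slices-downward : ∀ {u w} → u ∈ VG D → InSlice D p u → w ∈ VG D → InSlice D q w →
      suc p < q → A w ≡ true → A u ≡ true
    nonadjacent-slices-downward {u} {w} u∈ u∈p w∈ w∈q 1+p<q Aw =
      downward-across-slices-fixing-middles u v u∈ v∈ (sameMiddles λ k → sym (splice-middle t u w k))
        u∈p v∈1+p (n<1+n p)
        (downward-across-slices-fixing-last v w v∈ w∈ (splice-last t u w) v∈1+p w∈q 1+p<q Aw)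
      where
      1+p<len : suc p < length (lss D fz)
      1+p<len = <-trans 1+p<q (proj₁ w∈q)

      t : ℕ
      t = partStart fz (suc p)

      v : Vec ℕ N
      v = splice t u w

      v∈ : v ∈ VG D
      v∈ = splice-∈VG t u w (partStart<n fz 1+p<len) u∈ w∈

      v∈1+p : InSlice D (suc p) v
      v∈1+p = InSlice-partStart {x = v} 1+p<len refl

    slices-adjacent : ∀ {u w} → u ∈ VG D → InSlice D p u → A u ≡ false → w ∈ VG D → InSlice D q w → A w ≡ true →
      q ≡ suc p
    slices-adjacent u∈ u∈p ¬Au w∈ w∈q Aw =
      ≤-antisym (≮⇒≥ λ 1+p<q →
        contradiction (trans (sym (nonadjacent-slices-downward u∈ u∈p w∈ w∈q 1+p<q Aw)) ¬Au) λ ()) p<q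

lemma12 : (e : ℕ) (D : Data (suc (suc (suc e)))) → Standing D →
    (A : Vec ℕ (suc (suc (suc e))) → Bool) →
    StronglyCompressed D A → SliceCompressed D A →
    (p q : ℕ) → p < q →
    (∃ λ w → w ∈ VG D × InSlice D q w × A w ≡ true) →
    (∃ λ w → w ∈ VG D × InSlice D p w × A w ≡ false) →
    (αq αp : Vec ℕ (suc (suc (suc e)))) →
    FirstStack D q αq → LastStack D p αp →
      (∀ w → w ∈ VG D → InSlice D q w → stackKey D w ≢ αq → A w ≡ false)
    × (∀ w → w ∈ VG D → InSlice D p w → stackKey D w ≢ αp → A w ≡ true)
    × (q ≡ suc p)
lemma12 e D st A compressed _ p q p<q (w , w∈ , w∈q , Aw) (u , u∈ , u∈p , ¬Au) αq αp αq-first αp-last =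
    outside-firstStack-disjoint p<q {u} u∈ u∈p ¬Au αq-first
  , outside-lastStack-contained p<q {w} w∈ w∈q Aw αp-last
  , slices-adjacent p<q {u} {w} u∈ u∈p ¬Au w∈ w∈q Aw
  where
  open Standing st
  open Stacks e D isOrder (λ i → proj₁ (partition i)) (λ i → proj₁ (proj₂ (partition i))) A compressed
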